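{- If $(X,\vartriangleleft,R,Q)$ is a negative modal frame, then for every $c_\vartriangleleft$-fixpoint $A$, $\neg_\vartriangleleft\Diamond_QA\subseteq\Box_R\neg_\vartriangleleft A$.
   Context: A modal frame is a tuple $(X,\vartriangleleft,R,Q)$ with $X$ nonempty and $\vartriangleleft,R,Q$ binary relations on $X$ such that for all $x,y,z$: if $xRy$ and $z\vartriangleleft y$, then there is $x'\vartriangleleft x$ such that for all $x''$ with $x'\vartriangleleft x''$ there is $y''$ with $x''Ry''$ and $z\vartriangleleft y''$. It is negative if for all $x,y,z$: if $xRy$ and $z\vartriangleleft y$, then there is $x'\vartriangleleft x$ such that for all $x''\vartriangleleft x'$ there is $y''$ with $x''Qy''$ and $y''\vartriangleleft z$. ($u\vartriangleright v$ means $v\vartriangleleft u$.) $c_\vartriangleleft(A)=\{x\mid \forall y\vartriangleleft x\ \exists z\vartriangleright y: z\in A\}$. $\neg_\vartriangleleft A=\{x\mid \forall y\vartriangleleft x,\ y\notin A\}$; $\Box_RA=\{x\mid \forall y(xRy\Rightarrow y\in A)\}$; $\Diamond_QA=\{x\mid \forall x'\vartriangleleft x\ \exists y'\,(x'Qy')\ \exists y\vartriangleright y': y\in A\}$. -}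

module Defs where

open import Level using (Level; _⊔_; suc)
open import Data.Product using (Σ; ∃; _×_; _,_)
open import Relation.Nullary using (¬_)

Pred : ∀ {a} (X : Set a) (ℓ : Level) → Set (a ⊔ suc ℓ)
Pred X ℓ = X → Set ℓ

Rel : ∀ {a} (X : Set a) (ℓ : Level) → Set (a ⊔ suc ℓ)
Rel X ℓ = X → X → Set ℓ

_⊆_ : ∀ {a ℓ₁ ℓ₂} {X : Set a} → Pred X ℓ₁ → Pred X ℓ₂ → Set (a ⊔ ℓ₁ ⊔ ℓ₂)
A ⊆ B = ∀ x → A x → B x

record ModalFrame (a ℓ : Level) : Set (suc (a ⊔ ℓ)) where
  field
    X : Set a
    nonempty : X
    _◁_ : Rel X ℓ
    R : Rel X ℓ
    Q : Rel X ℓ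
    frame-cond : ∀ x y z → R x y → z ◁ y →
      Σ X (λ x' → (x' ◁ x) ×
        (∀ x'' → x' ◁ x'' → Σ X (λ y'' → R x'' y'' × (z ◁ y''))))

module _ {a ℓ : Level} (F : ModalFrame a ℓ) where
  open ModalFrame F

  IsNegative : Set (a ⊔ ℓ)
  IsNegative = ∀ x y z → R x y → z ◁ y →
      Σ X (λ x' → (x' ◁ x) ×
        (∀ x'' → x'' ◁ x' → Σ X (λ y'' → Q x'' y'' × (y'' ◁ z))))

  c◁ : ∀ {p} → Pred X p → Pred X (a ⊔ ℓ ⊔ p)
  c◁ A x = ∀ y → y ◁ x → Σ X (λ z → (y ◁ z) × A z)

  IsFixpoint : ∀ {p} → Pred X p → Set (a ⊔ ℓ ⊔ p)
  IsFixpoint A = (c◁ A ⊆ A) × (A ⊆ c◁ A)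

  neg◁ : ∀ {p} → Pred X p → Pred X (a ⊔ ℓ ⊔ p)
  neg◁ A x = ∀ y → y ◁ x → ¬ A y

  □R : ∀ {p} → Pred X p → Pred X (a ⊔ ℓ ⊔ p)
  □R A x = ∀ y → R x y → A y

  ◇Q : ∀ {p} → Pred X p → Pred X (a ⊔ ℓ ⊔ p)
  ◇Q A x = ∀ x' → x' ◁ x →
    Σ X (λ y' → Q x' y' × Σ X (λ y → (y' ◁ y) × A y))

{-# OPTIONS --safe #-}
module Submission where

open import Level using (Level)
open import Data.Product using (Σ-syntax; _×_; _,_)
open import Defs

module NegativeFrame {a ℓ : Level} (F : ModalFrame a ℓ) (negative : IsNegative F) where
  open ModalFrame F

  ◇Q-below-R-successor : ∀ {p} {A : Pred X p} {x y z} →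
    R x y → z ◁ y → A z → Σ[ x' ∈ X ] (x' ◁ x × ◇Q F A x')
  ◇Q-below-R-successor {x = x} {y} {z} xRy z◁y Az =
    let (x' , x'◁x , Q-below-z) = negative x y z xRy z◁y in
    x' , x'◁x , λ x'' x''◁x' →
      let (y'' , x''Qy'' , y''◁z) = Q-below-z x'' x''◁x' in y'' , x''Qy'' , z , y''◁z , Az

  neg◁-◇Q⊆□R-neg◁ : ∀ {p} (A : Pred X p) → neg◁ F (◇Q F A) ⊆ □R F (neg◁ F A)
  neg◁-◇Q⊆□R-neg◁ A x x∈¬◇A y xRy z z◁y Az =
    let (x' , x'◁x , x'∈◇A) = ◇Q-below-R-successor xRy z◁y Az in x∈¬◇A x' x'◁x x'∈◇A

-- The inclusion holds for every A.
proposition4p9 : ∀ {a ℓ p : Level} (F : ModalFrame a ℓ) → IsNegative F →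
    (A : Pred (ModalFrame.X F) p) → IsFixpoint F A →
    neg◁ F (◇Q F A) ⊆ □R F (neg◁ F A)
proposition4p9 F negative A _ = NegativeFrame.neg◁-◇Q⊆□R-neg◁ F negative A
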